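{- Let $s,t$ be positive integers, put $q=s-1$ and $r=s+t-1$, and let $u_{ -1}=1/s$, $u_0=1$, $u_n=ru_{n-1}+su_{n-2}$ for $n\ge1$. Every nonnegative integer $m$ has a unique representation $R(m)=\sum_{i=0}^{n}d_iu_i$ with digits $d_i\in\{0,\dots,r\}$ satisfying $d_{i+1}=r\implies d_i\le q$ for all $i\ge0$. Let $0=V_0<V_1<V_2<\cdots$ be the increasing enumeration of all evil numbers, and for each $k\ge0$ let $W_k$ be the integer with $R(W_k)=LR(V_k)$. Then $W_k-sV_k=tk$ for all $k\ge0$.
   Context: A positive integer $m$ is evil if its representation $R(m)$ ends in an even number (possibly zero) of zero digits, i.e. the least index $i$ with $d_i\neq 0$ is even; it is old if that number is odd; by convention $0$ is both evil and old. The left shift of a representation $R(m)=\sum_{i=0}^{n}d_iu_i$ is $LR(m)=\sum_{i=0}^{n}d_iu_{i+1}$ (this is again a valid representation). -}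

module Defs where

open import Data.Nat using (ℕ; zero; suc; _+_; _*_; _∸_; _≤_; _<_)
open import Data.Nat.Properties using ()
open import Data.Nat.Divisibility using (_∣_)
open import Data.List using (List; []; _∷_)
open import Data.Product using (Σ; ∃; _×_; _,_)
open import Data.Sum using (_⊎_)
open import Relation.Binary.PropositionalEquality using (_≡_)
open import Function.Bundles using (_⇔_)

q : ℕ → ℕ
q s = s ∸ 1

r : ℕ → ℕ → ℕ
r s t = s + t ∸ 1

-- u_0 = 1, u_1 = r u_0 + s u_{-1} = r + 1, u_n = r u_{n-1} + s u_{n-2} (n ≥ 2).
u : ℕ → ℕ → ℕ → ℕ
u s t zero = 1
u s t (suc zero) = r s t + 1
u s t (suc (suc n)) = r s t * u s t (suc n) + s * u s t n

-- A digit list [d_0, d_1, ..., d_n] (least significant first) represents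
-- sum_i d_i u_{i+k} when evaluated from offset k.
valFrom : ℕ → ℕ → ℕ → List ℕ → ℕ
valFrom s t k [] = 0
valFrom s t k (d ∷ ds) = d * u s t k + valFrom s t (suc k) ds

val : ℕ → ℕ → List ℕ → ℕ
val s t = valFrom s t 0

data Valid (s t : ℕ) : List ℕ → Set where
  nil  : Valid s t []
  one  : ∀ {d} → d ≤ r s t → Valid s t (d ∷ [])
  cons : ∀ {d e ds} → d ≤ r s t → (e ≡ r s t → d ≤ q s) →
         Valid s t (e ∷ ds) → Valid s t (d ∷ e ∷ ds)

lowZeros : List ℕ → ℕ
lowZeros [] = 0
lowZeros (zero ∷ ds) = suc (lowZeros ds)
lowZeros (suc _ ∷ ds) = 0

Evil : ℕ → ℕ → ℕ → Set
Evil s t m = m ≡ 0 ⊎ Σ (List ℕ) λ ds → Valid s t ds × val s t ds ≡ m × 2 ∣ lowZeros ds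

shiftL : List ℕ → List ℕ
shiftL ds = 0 ∷ ds

IsEvilEnumeration : ℕ → ℕ → (ℕ → ℕ) → Set
IsEvilEnumeration s t V =
  (∀ k → V k < V (suc k)) × (∀ m → Evil s t m ⇔ ∃ λ k → V k ≡ m)

{-# OPTIONS --safe #-}
module Submission where

open import Defs
open import Data.Nat using (ℕ; zero; suc; _+_; _*_; _≤_; _<_; z≤n; s≤s; s≤s⁻¹; z<s; NonZero; >-nonZero; _≟_; _<?_)
open import Data.Nat.Properties
open import Data.Nat.DivMod using (_%_; m<n⇒m%n≡m; [m+kn]%n≡m%n)
open import Data.Nat.Divisibility using (_∣_; _∣0; n∣n; ∣m∣n⇒∣m+n; ∣m+n∣m⇒∣n; >⇒∤)
open import Data.Nat.Tactic.RingSolver using (solve-∀)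
open import Data.List using (List; []; _∷_)
open import Data.Product using (∃; _×_; _,_; proj₁; proj₂)
open import Data.Sum using (inj₁; inj₂)
open import Relation.Nullary using (¬_; yes; no; contradiction)
open import Relation.Binary.PropositionalEquality
  using (_≡_; _≢_; refl; sym; trans; cong; cong₂; subst; module ≡-Reasoning)
open import Function.Bundles using (_⇔_; Equivalence)

-- Representations are unique up to leading zeros: scanning from the least significant
-- end, the digits below position j are worth less than u_j, and less than s·u_{j-1}
-- when the digit at position j is r.  Adding 1 to a representation whose lowest digit
-- is not r yields one with an even number of trailing zeros (a carry turns q r into 0 0,
-- as (q+1)u_j + r u_{j+1} = u_{j+2}).  So V_{k+1} = V_k + 1 unless R(V_k) has lowest
-- digit r and higher digits D; then V_k + 1 is represented by 0 followed by D + 1, which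
-- ends in an odd number of zeros, while V_k + 2 is evil, so V_{k+1} = V_k + 2.  In both
-- cases the left shift grows by s(V_{k+1} - V_k) + t, because u_1 = s + t and u_2 = r u_1 + s.

2∣n⇒2∣2+n : ∀ {n} → 2 ∣ n → 2 ∣ 2 + n
2∣n⇒2∣2+n = ∣m∣n⇒∣m+n n∣n

2∣n⇒2∤1+n : ∀ {n} → 2 ∣ n → ¬ 2 ∣ suc n
2∣n⇒2∤1+n {n} 2∣n 2∣1+n =
  >⇒∤ (s≤s (s≤s z≤n)) (∣m+n∣m⇒∣n (subst (2 ∣_) (+-comm 1 n) 2∣1+n) 2∣n)

digit-cancel : ∀ {v a b} d e → a < v → b < v → a + d * v ≡ b + e * v → d ≡ e × a ≡ b
digit-cancel {v} {a} {b} d e a<v b<v eq = d≡e , a≡b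
  where
  open ≡-Reasoning
  instance
    v≢0 : NonZero v
    v≢0 = >-nonZero (≤-<-trans z≤n a<v)
  a≡b : a ≡ b
  a≡b = begin
    a               ≡⟨ m<n⇒m%n≡m a<v ⟨
    a % v           ≡⟨ [m+kn]%n≡m%n a d v ⟨
    (a + d * v) % v ≡⟨ cong (_% v) eq ⟩
    (b + e * v) % v ≡⟨ [m+kn]%n≡m%n b e v ⟩
    b % v           ≡⟨ m<n⇒m%n≡m b<v ⟩
    b               ∎
  d≡e : d ≡ e
  d≡e = *-cancelʳ-≡ d e v (+-cancelˡ-≡ b _ _ (subst (λ x → x + d * v ≡ b + e * v) a≡b eq))

module IncreasingEnumeration {P : ℕ → Set} {V : ℕ → ℕ}
  (V-step : ∀ k → V k < V (suc k)) (enumerates : ∀ m → P m ⇔ ∃ λ k → V k ≡ m) where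

  V-mono-< : ∀ {i j} → i < j → V i < V j
  V-mono-< {i} {suc j} i<1+j with m<1+n⇒m<n∨m≡n i<1+j
  ... | inj₁ i<j  = <-trans (V-mono-< i<j) (V-step j)
  ... | inj₂ refl = V-step j

  V-mono-≤ : ∀ {i j} → i ≤ j → V i ≤ V j
  V-mono-≤ i≤j with m≤n⇒m<n∨m≡n i≤j
  ... | inj₁ i<j  = <⇒≤ (V-mono-< i<j)
  ... | inj₂ refl = ≤-refl

  P-V : ∀ k → P (V k)
  P-V k = Equivalence.from (enumerates (V k)) (k , refl)

  V-zero : P 0 → V 0 ≡ 0
  V-zero P0 with Equivalence.to (enumerates 0) P0
  ... | j , Vj≡0 = n≤0⇒n≡0 (subst (V 0 ≤_) Vj≡0 (V-mono-≤ z≤n))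

  V-suc-least : ∀ {k n} → P n → V k < n → V (suc k) ≤ n
  V-suc-least {k} Pn Vk<n with Equivalence.to (enumerates _) Pn
  ... | j , refl with k <? j
  ...   | yes k<j = V-mono-≤ k<j
  ...   | no  k≮j = contradiction Vk<n (≤⇒≯ (V-mono-≤ (≮⇒≥ k≮j)))

  V-suc-next : ∀ {k} → P (suc (V k)) → V (suc k) ≡ suc (V k)
  V-suc-next {k} P1+Vk = ≤-antisym (V-suc-least P1+Vk (n<1+n (V k))) (V-step k)

  V-suc-skip : ∀ {k} → ¬ P (suc (V k)) → P (2 + V k) → V (suc k) ≡ 2 + V k
  V-suc-skip {k} ¬P1+Vk P2+Vk with m≤n⇒m<n∨m≡n (V-suc-least P2+Vk (≤-trans (n<1+n _) (n≤1+n _)))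
  ... | inj₂ Vsk≡2+Vk = Vsk≡2+Vk
  ... | inj₁ Vsk<2+Vk = contradiction (subst P (≤-antisym (s≤s⁻¹ Vsk<2+Vk) (V-step k)) (P-V (suc k))) ¬P1+Vk

lowDigit : List ℕ → ℕ
lowDigit []      = 0
lowDigit (d ∷ _) = d

infix 4 _≋_
data _≋_ : List ℕ → List ℕ → Set where
  []  : [] ≋ []
  0∷ˡ : ∀ {ds} → ds ≋ [] → 0 ∷ ds ≋ []
  0∷ʳ : ∀ {es} → [] ≋ es → [] ≋ 0 ∷ es
  _∷_ : ∀ d {ds es} → ds ≋ es → d ∷ ds ≋ d ∷ es

≋⇒valFrom≡ : ∀ {s t ds es} → ds ≋ es → ∀ j → valFrom s t j ds ≡ valFrom s t j es
≋⇒valFrom≡ []            j = refl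
≋⇒valFrom≡ (0∷ˡ ds≋[])   j = ≋⇒valFrom≡ ds≋[] (suc j)
≋⇒valFrom≡ (0∷ʳ []≋es)   j = ≋⇒valFrom≡ []≋es (suc j)
≋⇒valFrom≡ {s} {t} (d ∷ ds≋es) j = cong (d * u s t j +_) (≋⇒valFrom≡ ds≋es (suc j))

≋⇒lowZeros≡ : ∀ {s t ds es} → ds ≋ es → ∀ j → valFrom s t j ds ≢ 0 → lowZeros ds ≡ lowZeros es
≋⇒lowZeros≡ []               j _   = refl
≋⇒lowZeros≡ (0∷ˡ ds≋[])      j ≢0  = contradiction (≋⇒valFrom≡ ds≋[] (suc j)) ≢0
≋⇒lowZeros≡ (0∷ʳ _)          j ≢0  = contradiction refl ≢0
≋⇒lowZeros≡ (zero ∷ ds≋es)   j ≢0  = cong suc (≋⇒lowZeros≡ ds≋es (suc j) ≢0)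
≋⇒lowZeros≡ (suc _ ∷ _)      j _   = refl

module Numeration (s₀ t₀ : ℕ) where

  s : ℕ
  s = suc s₀

  t : ℕ
  t = suc t₀

  U : ℕ → ℕ
  U = u s t

  R : ℕ
  R = r s t

  Q : ℕ
  Q = q s

  -- sU j = s·u_{j-1}, reading u_{-1} = 1/s
  sU : ℕ → ℕ
  sU zero    = 1
  sU (suc j) = s * U j

  u-suc : ∀ j → U (suc j) ≡ R * U j + sU j
  u-suc zero    = cong (_+ 1) (sym (*-identityʳ R))
  u-suc (suc j) = refl

  Q<R : Q < R
  Q<R = m<m+n s₀ z<s

  0≢R : 0 ≢ R
  0≢R 0≡R = m<n⇒n≢0 Q<R (sym 0≡R)

  Admissible : ℕ → ℕ → Set
  Admissible d e = d ≤ R × (e ≡ R → d ≤ Q)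

  0-admissible : ∀ {e} → Admissible 0 e
  0-admissible = z≤n , λ _ → z≤n

  valid-head : ∀ {d ds} → Valid s t (d ∷ ds) → Admissible d (lowDigit ds)
  valid-head (one d≤R)            = d≤R , λ 0≡R → contradiction 0≡R 0≢R
  valid-head (cons d≤R e≡R⇒d≤Q _) = d≤R , e≡R⇒d≤Q

  valid-tail : ∀ {d ds} → Valid s t (d ∷ ds) → Valid s t ds
  valid-tail (one _)      = nil
  valid-tail (cons _ _ v) = v

  0∷-valid : ∀ {ds} → Valid s t ds → Valid s t (0 ∷ ds)
  0∷-valid nil            = one z≤n
  0∷-valid v@(one _)      = cons z≤n (λ _ → z≤n) v
  0∷-valid v@(cons _ _ _) = cons z≤n (λ _ → z≤n) v

  no-consecutive-R : ∀ {ds} → Valid s t (R ∷ ds) → lowDigit ds ≢ R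
  no-consecutive-R v low≡R = <⇒≱ Q<R (proj₂ (valid-head v) low≡R)

  increment : List ℕ → List ℕ
  increment []           = 1 ∷ []
  increment (d ∷ [])     = suc d ∷ []
  increment (d ∷ e ∷ es) with d ≟ Q | e ≟ R
  ... | yes _ | yes _ = 0 ∷ 0 ∷ increment es
  ... | _     | _     = suc d ∷ e ∷ es

  valFrom-increment : ∀ j ds → valFrom s t j (increment ds) ≡ U j + valFrom s t j ds
  valFrom-increment j []       = cong (_+ 0) (*-identityˡ (U j))
  valFrom-increment j (d ∷ []) = +-assoc (U j) (d * U j) 0
  valFrom-increment j (d ∷ e ∷ es) with d ≟ Q | e ≟ R
  ... | yes refl | yes refl = begin
    valFrom s t (2 + j) (increment es)    ≡⟨ valFrom-increment (2 + j) es ⟩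
    U (2 + j) + X                         ≡⟨ regroup (R * U (suc j)) (U j) (Q * U j) X ⟩
    U j + (Q * U j + (R * U (suc j) + X)) ∎
    where
    open ≡-Reasoning
    X : ℕ
    X = valFrom s t (2 + j) es
    -- U (2 + j) unfolds to R * U (1 + j) + (U j + Q * U j), as s = suc Q
    regroup : ∀ a b c x → (a + (b + c)) + x ≡ b + (c + (a + x))
    regroup = solve-∀
  ... | yes refl | no _ = +-assoc (U j) (Q * U j) _
  ... | no _     | _    = +-assoc (U j) (d * U j) _

  increment-valid : ∀ {ds} → Valid s t ds → lowDigit ds ≢ R → Valid s t (increment ds)
  increment-valid nil            _   = one (≤-trans (s≤s z≤n) Q<R)
  increment-valid (one d≤R)      d≢R = one (≤∧≢⇒< d≤R d≢R)
  increment-valid (cons {d} {e} d≤R e≡R⇒d≤Q ve) d≢R with d ≟ Q | e ≟ R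
  ... | yes refl | yes refl = 0∷-valid (0∷-valid (increment-valid (valid-tail ve) (no-consecutive-R ve)))
  ... | yes refl | no e≢R   = cons (≤∧≢⇒< d≤R d≢R) (λ e≡R → contradiction e≡R e≢R) ve
  ... | no d≢Q   | _        = cons (≤∧≢⇒< d≤R d≢R) (λ e≡R → ≤∧≢⇒< (e≡R⇒d≤Q e≡R) d≢Q) ve

  2∣lowZeros-increment : ∀ ds → 2 ∣ lowZeros (increment ds)
  2∣lowZeros-increment []       = 2 ∣0
  2∣lowZeros-increment (d ∷ []) = 2 ∣0
  2∣lowZeros-increment (d ∷ e ∷ es) with d ≟ Q | e ≟ R
  ... | yes _ | yes _ = 2∣n⇒2∣2+n (2∣lowZeros-increment es)
  ... | yes _ | no _  = 2 ∣0
  ... | no _  | _     = 2 ∣0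

  valFrom-carry : ∀ j ds → valFrom s t j (0 ∷ increment ds) ≡ sU j + valFrom s t j (R ∷ ds)
  valFrom-carry j ds = begin
    valFrom s t (suc j) (increment ds) ≡⟨ valFrom-increment (suc j) ds ⟩
    U (suc j) + X                      ≡⟨ cong (_+ X) (u-suc j) ⟩
    (R * U j + sU j) + X               ≡⟨ cong (_+ X) (+-comm (R * U j) (sU j)) ⟩
    (sU j + R * U j) + X               ≡⟨ +-assoc (sU j) (R * U j) X ⟩
    sU j + (R * U j + X)               ∎
    where
    open ≡-Reasoning
    X : ℕ
    X = valFrom s t (suc j) ds

  -- The bound met by the value a of valid digits below position j when the digit at j is d.
  CarryBound : ℕ → ℕ → ℕ → Set
  CarryBound j d a = a < U j × (d ≡ R → a < sU j)

  carryBound-step : ∀ {j d e a} → Admissible d e → CarryBound j d a →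
                    CarryBound (suc j) e (a + d * U j)
  carryBound-step {j} {d} {e} {a} (d≤R , e≡R⇒d≤Q) (a<U , d≡R⇒a<sU) = below-U , e≡R⇒below-sU
    where
    open ≤-Reasoning
    below-[1+d]U : a + d * U j < suc d * U j
    below-[1+d]U = +-monoˡ-< (d * U j) a<U
    below-U : a + d * U j < U (suc j)
    below-U with d ≟ R
    ... | yes d≡R = begin-strict
      a + d * U j     <⟨ +-monoˡ-< (d * U j) (d≡R⇒a<sU d≡R) ⟩
      sU j + d * U j  ≡⟨ +-comm (sU j) (d * U j) ⟩
      d * U j + sU j  ≡⟨ cong (λ x → x * U j + sU j) d≡R ⟩
      R * U j + sU j  ≡⟨ u-suc j ⟨
      U (suc j)       ∎
    ... | no d≢R = begin-strict
      a + d * U j     <⟨ below-[1+d]U ⟩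
      suc d * U j     ≤⟨ *-monoˡ-≤ (U j) (≤∧≢⇒< d≤R d≢R) ⟩
      R * U j         ≤⟨ m≤m+n (R * U j) (sU j) ⟩
      R * U j + sU j  ≡⟨ u-suc j ⟨
      U (suc j)       ∎
    e≡R⇒below-sU : e ≡ R → a + d * U j < s * U j
    e≡R⇒below-sU e≡R = <-≤-trans below-[1+d]U (*-monoˡ-≤ (U j) (s≤s (e≡R⇒d≤Q e≡R)))

  private
    reassoc : ∀ {a b v x y} d e → a + (d * v + x) ≡ b + (e * v + y) → (a + d * v) + x ≡ (b + e * v) + y
    reassoc {a} {b} _ _ eq = trans (+-assoc a _ _) (trans eq (sym (+-assoc b _ _)))

  valFrom-injective : ∀ {j a b} ds es → Valid s t ds → Valid s t es →
                      CarryBound j (lowDigit ds) a → CarryBound j (lowDigit es) b →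
                      a + valFrom s t j ds ≡ b + valFrom s t j es → a ≡ b × ds ≋ es
  valFrom-injective {a = a} {b} [] [] _ _ _ _ eq = +-cancelʳ-≡ 0 a b eq , []
  valFrom-injective {j} {a} {b} [] (e ∷ es) _ ve ca cb eq
    with valFrom-injective {suc j} [] es nil (valid-tail ve)
           (carryBound-step {j} 0-admissible ca) (carryBound-step {j} (valid-head ve) cb)
           (reassoc {a} {b} {U j} 0 e eq)
  ... | a′≡b′ , []≋es with digit-cancel 0 e (proj₁ ca) (proj₁ cb) a′≡b′
  ...   | refl , a≡b = a≡b , 0∷ʳ []≋es
  valFrom-injective {j} {a} {b} (d ∷ ds) [] vd _ ca cb eq
    with valFrom-injective {suc j} ds [] (valid-tail vd) nil
           (carryBound-step {j} (valid-head vd) ca) (carryBound-step {j} 0-admissible cb)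
           (reassoc {a} {b} {U j} d 0 eq)
  ... | a′≡b′ , ds≋[] with digit-cancel d 0 (proj₁ ca) (proj₁ cb) a′≡b′
  ...   | refl , a≡b = a≡b , 0∷ˡ ds≋[]
  valFrom-injective {j} {a} {b} (d ∷ ds) (e ∷ es) vd ve ca cb eq
    with valFrom-injective {suc j} ds es (valid-tail vd) (valid-tail ve)
           (carryBound-step {j} (valid-head vd) ca) (carryBound-step {j} (valid-head ve) cb)
           (reassoc {a} {b} {U j} d e eq)
  ... | a′≡b′ , ds≋es with digit-cancel d e (proj₁ ca) (proj₁ cb) a′≡b′
  ...   | refl , a≡b = a≡b , d ∷ ds≋es

  val-injective : ∀ {ds es} → Valid s t ds → Valid s t es → val s t ds ≡ val s t es → ds ≋ es
  val-injective {ds} {es} vd ve eq =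
    proj₂ (valFrom-injective ds es vd ve (z<s , λ _ → z<s) (z<s , λ _ → z<s) eq)

  evil⇒2∣lowZeros : ∀ {ds} → Valid s t ds → val s t ds ≢ 0 → Evil s t (val s t ds) → 2 ∣ lowZeros ds
  evil⇒2∣lowZeros _  ≢0 (inj₁ ≡0) = contradiction ≡0 ≢0
  evil⇒2∣lowZeros vd ≢0 (inj₂ (es , ve , es≡ , 2∣es)) =
    subst (2 ∣_) (≋⇒lowZeros≡ (val-injective ve vd es≡) 0 (λ es≡0 → ≢0 (trans (sym es≡) es≡0))) 2∣es

  increment-evil : ∀ {ds} → Valid s t ds → lowDigit ds ≢ R → Evil s t (suc (val s t ds))
  increment-evil {ds} vd low≢R =
    inj₂ (increment ds , increment-valid vd low≢R , valFrom-increment 0 ds , 2∣lowZeros-increment ds)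

  carry-valid : ∀ {ds} → Valid s t (R ∷ ds) → Valid s t (0 ∷ increment ds)
  carry-valid vd = 0∷-valid (increment-valid (valid-tail vd) (no-consecutive-R vd))

  carry-not-evil : ∀ {ds} → Valid s t (R ∷ ds) → ¬ Evil s t (suc (val s t (R ∷ ds)))
  carry-not-evil {ds} vd evil = 2∣n⇒2∤1+n (2∣lowZeros-increment ds)
    (evil⇒2∣lowZeros (carry-valid vd) (λ ≡0 → contradiction (trans (sym (valFrom-carry 0 ds)) ≡0) λ ())
      (subst (Evil s t) (sym (valFrom-carry 0 ds)) evil))

  carry-evil : ∀ {ds} → Valid s t (R ∷ ds) → Evil s t (2 + val s t (R ∷ ds))
  carry-evil {ds} vd =
    subst (λ m → Evil s t (suc m)) (valFrom-carry 0 ds) (increment-evil (carry-valid vd) 0≢R)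

  ShiftWitness : (ℕ → ℕ) → ℕ → Set
  ShiftWitness V k = ∃ λ ds → Valid s t ds × val s t ds ≡ V k × valFrom s t 1 ds ≡ s * V k + t * k

  module _ {V : ℕ → ℕ} (E : IsEvilEnumeration s t V) where
    open IncreasingEnumeration (proj₁ E) (proj₂ E)

    witness-increment : ∀ {k ds} → Valid s t ds → val s t ds ≡ V k → valFrom s t 1 ds ≡ s * V k + t * k →
                        lowDigit ds ≢ R → ShiftWitness V (suc k)
    witness-increment {k} {ds} vd ds≡ shift≡ low≢R =
      increment ds , increment-valid vd low≢R , val≡ , shift≡′
      where
      open ≡-Reasoning
      Vsk≡ : V (suc k) ≡ 1 + V k
      Vsk≡ = V-suc-next (subst (λ m → Evil s t (suc m)) ds≡ (increment-evil vd low≢R))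
      val≡ : val s t (increment ds) ≡ V (suc k)
      val≡ = trans (valFrom-increment 0 ds) (trans (cong suc ds≡) (sym Vsk≡))
      identity : ∀ s₀ t v k → (s₀ + t + 1) + (suc s₀ * v + t * k) ≡ suc s₀ * (1 + v) + t * suc k
      identity = solve-∀
      shift≡′ : valFrom s t 1 (increment ds) ≡ s * V (suc k) + t * suc k
      shift≡′ = begin
        valFrom s t 1 (increment ds) ≡⟨ valFrom-increment 1 ds ⟩
        U 1 + valFrom s t 1 ds       ≡⟨ cong (U 1 +_) shift≡ ⟩
        U 1 + (s * V k + t * k)      ≡⟨ identity s₀ t (V k) k ⟩
        s * (1 + V k) + t * suc k    ≡⟨ cong (λ v → s * v + t * suc k) Vsk≡ ⟨
        s * V (suc k) + t * suc k    ∎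

    witness-carry : ∀ {k ds} → Valid s t (R ∷ ds) → val s t (R ∷ ds) ≡ V k →
                    valFrom s t 1 (R ∷ ds) ≡ s * V k + t * k → ShiftWitness V (suc k)
    witness-carry {k} {ds} vd ds≡ shift≡ =
      increment es , increment-valid (carry-valid vd) 0≢R , val≡ , shift≡′
      where
      open ≡-Reasoning
      es : List ℕ
      es = 0 ∷ increment ds
      Vsk≡ : V (suc k) ≡ 2 + V k
      Vsk≡ = V-suc-skip (subst (λ m → ¬ Evil s t (suc m)) ds≡ (carry-not-evil vd))
                        (subst (λ m → Evil s t (2 + m)) ds≡ (carry-evil vd))
      val≡ : val s t (increment es) ≡ V (suc k)
      val≡ = trans (valFrom-increment 0 es) (trans (cong suc (valFrom-carry 0 ds))
               (trans (cong (2 +_) ds≡) (sym Vsk≡)))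
      identity : ∀ s₀ t v k → (s₀ + t + 1) + (suc s₀ * 1 + (suc s₀ * v + t * k)) ≡ suc s₀ * (2 + v) + t * suc k
      identity = solve-∀
      shift≡′ : valFrom s t 1 (increment es) ≡ s * V (suc k) + t * suc k
      shift≡′ = begin
        valFrom s t 1 (increment es)              ≡⟨ valFrom-increment 1 es ⟩
        U 1 + valFrom s t 1 es                    ≡⟨ cong (U 1 +_) (valFrom-carry 1 ds) ⟩
        U 1 + (s * 1 + valFrom s t 1 (R ∷ ds))    ≡⟨ cong (λ x → U 1 + (s * 1 + x)) shift≡ ⟩
        U 1 + (s * 1 + (s * V k + t * k))         ≡⟨ identity s₀ t (V k) k ⟩
        s * (2 + V k) + t * suc k                 ≡⟨ cong (λ v → s * v + t * suc k) Vsk≡ ⟨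
        s * V (suc k) + t * suc k                 ∎

    shift-witness : ∀ k → ShiftWitness V k
    shift-witness zero = [] , nil , sym V0≡0 ,
      sym (cong₂ _+_ (trans (cong (s *_) V0≡0) (*-zeroʳ s)) (*-zeroʳ t))
      where
      V0≡0 : V 0 ≡ 0
      V0≡0 = V-zero (inj₁ refl)
    shift-witness (suc k) with shift-witness k
    ... | []     , vd , ds≡ , shift≡ = witness-increment vd ds≡ shift≡ 0≢R
    ... | d ∷ ds , vd , ds≡ , shift≡ with d ≟ R
    ...   | yes refl = witness-carry vd ds≡ shift≡
    ...   | no d≢R   = witness-increment vd ds≡ shift≡ d≢R

lemma2 : (s t : ℕ) → 1 ≤ s → 1 ≤ t → (V : ℕ → ℕ) → IsEvilEnumeration s t V →
         (k : ℕ) → (ds : List ℕ) → Valid s t ds → val s t ds ≡ V k →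
         val s t (shiftL ds) ≡ s * V k + t * k
lemma2 (suc s₀) (suc t₀) (s≤s z≤n) (s≤s z≤n) V E k ds vd ds≡V =
  let es , ve , es≡V , shift≡ = shift-witness E k
  in trans (≋⇒valFrom≡ (val-injective vd ve (trans ds≡V (sym es≡V))) 1) shift≡
  where open Numeration s₀ t₀
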